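{- Let $G$ be a finite connected graph with at least one edge, $\Delta$ a decision tree for $G$ and $T$ a spanning tree of $G$. Run the following procedure: set $H':=G$, $n:=$ root of $\Delta$, $\mathrm{IntAct}:=\emptyset$; for $k=1,\dots,m$: let $e_k$ be the label of $n$; if $e_k\notin T$ and $e_k$ is not an isthmus of $H'$, set $H':=H'\setminus e_k$ and $n:=$ left child of $n$, otherwise set $n:=$ right child of $n$; then, if $e_k$ is (an edge of $H'$ and) an isthmus of $H'$, add $e_k$ to $\mathrm{IntAct}$. Then the output $\mathrm{IntAct}$ is exactly the set of edges of $\Delta$-type $\mathbf I$ for $T$.
   Context: Graphs are finite, loops and multiple edges allowed; $m=|E(G)|$. Subgraphs are spanning, identified with edge sets. An isthmus is an edge whose deletion increases the number of connected components; an edge is standard if neither a loop nor an isthmus. A decision tree for $G$ is a perfect binary tree with all leaves at depth $m-1$ (root at depth $0$), each node labelled by an edge of $G$, such that along every root-to-leaf path the labels form a permutation of $E(G)$. The $\Delta$-types for a subgraph $S$ are assigned by: set $H:=G$, $n:=$ root of $\Delta$; for $k=1,\dots,m$ let $e_k$ be the label of $n$ and do exactly one of: (i) if $e_k$ is standard in $H$ and $e_k\notin S$: type $\mathbf S_e$, $H:=H\setminus e_k$ (deletion), $n:=$ left child; (ii) if $e_k$ is a loop of $H$: type $\mathbf L$, $H:=H\setminus e_k$, $n:=$ left child; (iii) if $e_k$ is standard in $H$ and $e_k\in S$: type $\mathbf S_i$, $H:=H/e_k$ (contraction), $n:=$ right child; (iv) if $e_k$ is an isthmus of $H$: type $\mathbf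 I$, $H:=H/e_k$, $n:=$ right child. -}

module Defs where

open import Data.Nat using (ℕ; zero; suc)
open import Data.Fin using (Fin; _≟_)
open import Data.Fin.Subset using (Subset; _∈_; _∉_)
open import Data.Bool using (Bool; true; false; if_then_else_)
open import Data.Vec using (Vec; []; _∷_)
open import Data.List using (List; []; _∷_; allFin; _++_)
open import Data.List.Relation.Binary.Permutation.Propositional using (_↭_)
open import Data.Product using (_×_; _,_; proj₁; proj₂)
open import Data.Sum using (_⊎_)
open import Data.Unit using (⊤)
open import Relation.Nullary using (¬_; does)
open import Relation.Binary.PropositionalEquality using (_≡_; _≢_)

-- Finite multigraphs (loops and multiple edges allowed):
-- n vertices, m edges, each edge has an (unordered) pair of endpoints.

data Status : Set where
  present deleted contracted : Status

record Graph (n m : ℕ) : Set where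
  field
    ends : Fin m → Fin n × Fin n

module _ {n m : ℕ} (G : Graph n m) where
  open Graph G

  src tgt : Fin m → Fin n
  src e = proj₁ (ends e)
  tgt e = proj₂ (ends e)

  data Reach (P : Fin m → Set) : Fin n → Fin n → Set where
    here : ∀ {x} → Reach P x x
    step : ∀ {x y z} (e : Fin m) → P e →
           ((src e ≡ x × tgt e ≡ y) ⊎ (src e ≡ y × tgt e ≡ x)) →
           Reach P y z → Reach P x z

  Connected : Set
  Connected = ∀ x y → Reach (λ _ → ⊤) x y

-- A minor H = (G ∖ D) / C is encoded by a status function
-- on the edges of G: present (edge of H), deleted (in D), contracted (in C).
-- Vertices of H are the classes of vertices of G modulo reachability
-- through contracted edges.

  Minor : Set
  Minor = Fin m → Status

  initial : Minor
  initial _ = present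

  update : Minor → Fin m → Status → Minor
  update st e s f = if does (f ≟ e) then s else st f

  InH : Minor → Fin m → Set
  InH st e = st e ≡ present

  Loop : Minor → Fin m → Set
  Loop st e = InH st e × Reach (λ f → st f ≡ contracted) (src e) (tgt e)

  Isthmus : Minor → Fin m → Set
  Isthmus st e = InH st e ×
    ¬ Reach (λ f → f ≢ e × st f ≢ deleted) (src e) (tgt e)

  Standard : Minor → Fin m → Set
  Standard st e = InH st e × ¬ Loop st e × ¬ Isthmus st e

  -- Spanning tree: a set of edges T, connected and spanning, and acyclic
  -- (every edge of T is an isthmus of the spanning subgraph T).
  SpanningTree : Subset m → Set
  SpanningTree T =
    (∀ x y → Reach (λ f → f ∈ T) x y) ×
    (∀ e → e ∈ T → ¬ Reach (λ f → f ≢ e × f ∈ T) (src e) (tgt e))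

data BTree (A : Set) : ℕ → Set where
  leaf : A → BTree A zero
  node : ∀ {k} → A → BTree A k → BTree A k → BTree A (suc k)

-- direction: false = left child, true = right child
labelsAlong : ∀ {A k} → BTree A k → Vec Bool k → List A
labelsAlong (leaf a) [] = a ∷ []
labelsAlong (node a l r) (b ∷ bs) = a ∷ labelsAlong (if b then r else l) bs

-- Decision tree for a graph with m = suc k edges: leaves at depth m-1 = k,
-- labels along each root-to-leaf path form a permutation of E(G).
IsDecisionTree : ∀ {k} → BTree (Fin (suc k)) k → Set
IsDecisionTree {k} Δ = ∀ (path : Vec Bool k) → labelsAlong Δ path ↭ allFin (suc k)

data DType : Set where
  Se L Si I : DType

module _ {n m : ℕ} (G : Graph n m) (S : Subset m) where

  data TypeStep (st : Minor G) (e : Fin m) : DType → Minor G → Bool → Set where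
    stepSe : Standard G st e → e ∉ S → TypeStep st e Se (update G st e deleted) false
    stepL  : Loop G st e → TypeStep st e L (update G st e deleted) false
    stepSi : Standard G st e → e ∈ S → TypeStep st e Si (update G st e contracted) true
    stepI  : Isthmus G st e → TypeStep st e I (update G st e contracted) true

  data TypeRun : ∀ {k} → BTree (Fin m) k → Minor G → List (Fin m × DType) → Set where
    runLeaf : ∀ {st e t st' d} → TypeStep st e t st' d →
              TypeRun (leaf e) st ((e , t) ∷ [])
    runNode : ∀ {k st e t st' d out} {l r : BTree (Fin m) k} →
              TypeStep st e t st' d →
              TypeRun (if d then r else l) st' out →
              TypeRun (node e l r) st ((e , t) ∷ out)

module _ {n m : ℕ} (G : Graph n m) (T : Subset m) where

  data MoveStep (st : Minor G) (e : Fin m) : Minor G → Bool → Set where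
    goLeft   : e ∉ T → ¬ Isthmus G st e → MoveStep st e (update G st e deleted) false
    goRightT : e ∈ T → MoveStep st e st true
    goRightI : Isthmus G st e → MoveStep st e st true

  data Record (st : Minor G) (e : Fin m) : List (Fin m) → Set where
    add  : Isthmus G st e → Record st e (e ∷ [])
    skip : ¬ Isthmus G st e → Record st e []

  data ProcRun : ∀ {k} → BTree (Fin m) k → Minor G → List (Fin m) → Set where
    procLeaf : ∀ {st e st' d out} → MoveStep st e st' d → Record st' e out →
               ProcRun (leaf e) st out
    procNode : ∀ {k st e st' d out1 out2} {l r : BTree (Fin m) k} →
               MoveStep st e st' d → Record st' e out1 →
               ProcRun (if d then r else l) st' out2 →
               ProcRun (node e l r) st (out1 ++ out2)

module Submission where

-- Idea: run the Δ-type assignment and the procedure side by side down Δ.  The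
-- first walks through minors (G ∖ D) / C, the second through minors G ∖ D'.
-- Along a common path they satisfy the invariant `Agree`: D = D', D avoids T
-- and C ⊆ T.  Being an isthmus depends only on the deleted edges, so both
-- minors have the same isthmuses; a loop of (G ∖ D) / C is never in T (it
-- would close a cycle with C ⊆ T); an isthmus of G ∖ D lies in T (T spans and
-- avoids D).  Hence one step of both runs takes the same direction, keeps
-- `Agree`, and adds e to IntAct exactly when its type is I
-- (`step-correspondence`); induction along the tree gives `runs-correspond`.

open import Defs
open import Data.Nat using (ℕ; suc)
open import Data.Fin using (Fin) renaming (_≟_ to _≟ᶠ_)
open import Data.Fin.Subset using (Subset)
import Data.Fin.Subset as FS
open import Data.Fin.Subset.Properties using (_∈?_)
open import Data.List using (List; []; _∷_; _++_; allFin; filter)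
open import Data.List.Properties using (++-identityʳ)
open import Data.List.Membership.Propositional using (_∈_)
open import Data.List.Membership.Propositional.Properties using (∈-filter⁺; ∈-filter⁻; ∈-allFin)
open import Data.List.Relation.Unary.Any using (here; there)
open import Data.List.Relation.Unary.All using (All; []; _∷_; universal)
open import Data.List.Relation.Unary.Unique.Propositional using (Unique)
open import Data.List.Relation.Unary.Unique.Propositional.Properties using (allFin⁺)
open import Data.List.Relation.Unary.AllPairs using (_∷_)
open import Data.List.Relation.Binary.Permutation.Propositional using (↭-sym; ↭⇒↭ₛ)
open import Data.List.Relation.Binary.Permutation.Setoid.Properties using (Unique-resp-↭)
open import Data.Product using (Σ; _×_; _,_; proj₁; proj₂)
open import Data.Sum using (_⊎_; inj₁; inj₂)
open import Data.Bool using (Bool; true; false; if_then_else_)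
open import Data.Vec using ([]; _∷_; replicate)
open import Data.Empty using (⊥-elim)
open import Relation.Nullary using (¬_; Dec; yes; no)
open import Relation.Nullary.Decidable using (map′; _×-dec_; _⊎-dec_; ¬?; dec-true; dec-false)
open import Relation.Unary using (Pred; _⊆_; Decidable)
open import Relation.Binary.PropositionalEquality using (_≡_; _≢_; refl; sym; trans; subst; cong; setoid)
open import Function.Bundles using (_⇔_; mk⇔; Equivalence)
open import Level using (0ℓ)

_≟ˢ_ : (a b : Status) → Dec (a ≡ b)
present    ≟ˢ present    = yes refl
present    ≟ˢ deleted    = no (λ ())
present    ≟ˢ contracted = no (λ ())
deleted    ≟ˢ present    = no (λ ())
deleted    ≟ˢ deleted    = yes refl
deleted    ≟ˢ contracted = no (λ ())
contracted ≟ˢ present    = no (λ ())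
contracted ≟ˢ deleted    = no (λ ())
contracted ≟ˢ contracted = yes refl

module Reachability {n m : ℕ} (G : Graph n m) where

  reach-mono : ∀ {P Q : Pred (Fin m) 0ℓ} → P ⊆ Q → ∀ {x y} → Reach G P x y → Reach G Q x y
  reach-mono P⊆Q here           = here
  reach-mono P⊆Q (step e p o r) = step e (P⊆Q p) o (reach-mono P⊆Q r)

  reach-trans : ∀ {P x y z} → Reach G P x y → Reach G P y z → Reach G P x z
  reach-trans here           q = q
  reach-trans (step e p o r) q = step e p o (reach-trans r q)

  ReachVia : List (Fin m) → Fin n → Fin n → Set
  ReachVia es = Reach G (_∈ es)

  CrossingWalk : Fin m → List (Fin m) → Fin n → Fin n → Set
  CrossingWalk e es x y =
    ReachVia es x y ⊎
    ((ReachVia es x (src G e) × ReachVia es (tgt G e) y) ⊎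
     (ReachVia es x (tgt G e) × ReachVia es (src G e) y))

  split-at : ∀ e es {x y} → ReachVia (e ∷ es) x y → CrossingWalk e es x y
  split-at e es here = inj₁ here
  split-at e es (step f (there p) o r) with split-at e es r
  ... | inj₁ a                = inj₁ (step f p o a)
  ... | inj₂ (inj₁ (a , b))   = inj₂ (inj₁ (step f p o a , b))
  ... | inj₂ (inj₂ (a , b))   = inj₂ (inj₂ (step f p o a , b))
  split-at e es (step _ (here refl) (inj₁ (refl , refl)) r) with split-at e es r
  ... | inj₁ a                = inj₂ (inj₁ (here , a))
  ... | inj₂ (inj₁ (_ , b))   = inj₂ (inj₁ (here , b))
  ... | inj₂ (inj₂ (_ , b))   = inj₁ b
  split-at e es (step _ (here refl) (inj₂ (refl , refl)) r) with split-at e es r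
  ... | inj₁ a                = inj₂ (inj₂ (here , a))
  ... | inj₂ (inj₁ (_ , b))   = inj₁ b
  ... | inj₂ (inj₂ (_ , b))   = inj₂ (inj₂ (here , b))

  join-at : ∀ e es {x y} → CrossingWalk e es x y → ReachVia (e ∷ es) x y
  join-at e es (inj₁ a)              = reach-mono there a
  join-at e es (inj₂ (inj₁ (a , b))) =
    reach-trans (reach-mono there a) (step e (here refl) (inj₁ (refl , refl)) (reach-mono there b))
  join-at e es (inj₂ (inj₂ (a , b))) =
    reach-trans (reach-mono there a) (step e (here refl) (inj₂ (refl , refl)) (reach-mono there b))

  reachVia? : ∀ es x y → Dec (ReachVia es x y)
  reachVia? [] x y with x ≟ᶠ y
  ... | yes refl = yes here
  ... | no x≢y   = no λ { here → x≢y refl ; (step _ () _ _) }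
  reachVia? (e ∷ es) x y =
    map′ (join-at e es) (split-at e es)
      (reachVia? es x y ⊎-dec
        ((reachVia? es x (src G e) ×-dec reachVia? es (tgt G e) y) ⊎-dec
         (reachVia? es x (tgt G e) ×-dec reachVia? es (src G e) y)))

  reach? : ∀ {P : Pred (Fin m) 0ℓ} → Decidable P → ∀ x y → Dec (Reach G P x y)
  reach? P? x y =
    map′ (reach-mono (λ f∈ → proj₂ (∈-filter⁻ P? {xs = allFin m} f∈)))
         (reach-mono (λ {f} p → ∈-filter⁺ P? (∈-allFin f) p))
         (reachVia? (filter P? (allFin m)) x y)

module Minors {n m : ℕ} (G : Graph n m) where
  open Reachability G

  inH? : ∀ st → Decidable (InH G st)
  inH? st e = st e ≟ˢ present

  isthmus? : ∀ st → Decidable (Isthmus G st)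
  isthmus? st e =
    inH? st e ×-dec ¬? (reach? (λ f → ¬? (f ≟ᶠ e) ×-dec ¬? (st f ≟ˢ deleted)) (src G e) (tgt G e))

  loop? : ∀ st → Decidable (Loop G st)
  loop? st e = inH? st e ×-dec reach? (λ f → st f ≟ˢ contracted) (src G e) (tgt G e)

  update-same : ∀ st e s → update G st e s e ≡ s
  update-same st e s rewrite dec-true (e ≟ᶠ e) refl = refl

  update-other : ∀ st e s {f} → f ≢ e → update G st e s f ≡ st f
  update-other st e s {f} f≢e rewrite dec-false (f ≟ᶠ e) f≢e = refl

  contracted≢present : ∀ {st : Minor G} {f e} → st f ≡ contracted → st e ≡ present → f ≢ e
  contracted≢present c p refl with () ← trans (sym c) p

  -- A loop is no isthmus: the contracted edges joining its ends form a walk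
  -- avoiding the loop itself and every deleted edge.
  loop-not-isthmus : ∀ {st e} → Loop G st e → ¬ Isthmus G st e
  loop-not-isthmus {st} (inH , walk) (_ , noWalk) =
    noWalk (reach-mono (λ {f} c → contracted≢present {st} c inH , λ d → contracted≢deleted (trans (sym c) d)) walk)
    where
    contracted≢deleted : contracted ≢ deleted
    contracted≢deleted ()

  -- Being an isthmus depends only on the deleted edges: if st' deletes at
  -- least the edges st deletes, isthmuses of st present in st' stay isthmuses.
  isthmus-transfer : ∀ {st st' e} → (∀ f → st f ≡ deleted → st' f ≡ deleted) →
                     InH G st' e → Isthmus G st e → Isthmus G st' e
  isthmus-transfer del⊆del' inH' (_ , noWalk) =
    inH' , λ walk → noWalk (reach-mono (λ {f} (f≢e , ¬del') → f≢e , λ del → ¬del' (del⊆del' f del)) walk)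

  -- Along every path the labels are distinct edges of the current minor;
  -- this is what makes the Δ-type run possible.
  LabelsAvailable : ∀ {k} → BTree (Fin m) k → Minor G → Set
  LabelsAvailable Δ st = ∀ path → Unique (labelsAlong Δ path) × All (InH G st) (labelsAlong Δ path)

  labelsAvailable-child : ∀ {k} e (l r : BTree (Fin m) k) st s d →
    LabelsAvailable (node e l r) st → LabelsAvailable (if d then r else l) (update G st e s)
  labelsAvailable-child e l r st s d avail path with avail (d ∷ path)
  ... | (e∉rest ∷ unique) , (_ ∷ inHs) = unique , keep e∉rest inHs
    where
    keep : ∀ {xs} → All (e ≢_) xs → All (InH G st) xs → All (InH G (update G st e s)) xs
    keep []           []        = []
    keep (e≢x ∷ e≢xs) (p ∷ ps)  = trans (update-other st e s (λ x≡e → e≢x (sym x≡e))) p ∷ keep e≢xs ps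


-- In a decision tree every path lists each edge exactly once, and initially
-- every edge is present.
decisionTree-labelsAvailable : ∀ {n k} (G : Graph n (suc k)) {Δ : BTree (Fin (suc k)) k} →
  IsDecisionTree Δ → Minors.LabelsAvailable G Δ (initial G)
decisionTree-labelsAvailable G isDT path =
  Unique-resp-↭ (setoid _) (↭⇒↭ₛ (↭-sym (isDT path))) (allFin⁺ _) , universal (λ _ → refl) _

module Correspondence {n m : ℕ} (G : Graph n m) (T : Subset m) (tree : SpanningTree G T) where
  open Reachability G
  open Minors G

  record Agree (st st' : Minor G) : Set where
    field
      deleted⇒deleted' : ∀ f → st f ≡ deleted → st' f ≡ deleted
      deleted'⇒deleted : ∀ f → st' f ≡ deleted → st f ≡ deleted
      uncontracted'    : ∀ f → st' f ≢ contracted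
      contracted∈T     : ∀ f → st f ≡ contracted → f FS.∈ T
      deleted∉T        : ∀ f → st f ≡ deleted → f FS.∉ T
  open Agree

  agree-initial : Agree (initial G) (initial G)
  deleted⇒deleted' agree-initial f ()
  deleted'⇒deleted agree-initial f ()
  uncontracted'    agree-initial f ()
  contracted∈T     agree-initial f ()
  deleted∉T        agree-initial f ()

  present⇒present' : ∀ {st st'} → Agree st st' → ∀ {e} → InH G st e → InH G st' e
  present⇒present' {st' = st'} ag {e} inH with st' e in eq
  ... | present    = refl
  ... | deleted    with () ← trans (sym inH) (deleted'⇒deleted ag e eq)
  ... | contracted = ⊥-elim (uncontracted' ag e eq)

  -- A loop of (G ∖ D) / C is not in T: with C ⊆ T it would close a cycle in T.
  loop∉T : ∀ {st st' e} → Agree st st' → Loop G st e → e FS.∉ T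
  loop∉T {st} ag (inH , walk) e∈T =
    proj₂ tree _ e∈T (reach-mono (λ {f} c → contracted≢present {st} c inH , contracted∈T ag f c) walk)

  -- An isthmus of (G ∖ D) / C lies in T: otherwise the walk in T between its
  -- ends avoids it and (as D ∩ T = ∅) all deleted edges.
  isthmus∈T : ∀ {st st' e} → Agree st st' → Isthmus G st e → e FS.∈ T
  isthmus∈T {st} {e = e} ag (_ , noWalk) with e ∈? T
  ... | yes e∈T = e∈T
  ... | no e∉T  = ⊥-elim (noWalk (reach-mono avoid (proj₁ tree (src G e) (tgt G e))))
    where
    avoid : ∀ {f} → f FS.∈ T → f ≢ e × st f ≢ deleted
    avoid {f} f∈T = (λ { refl → e∉T f∈T }) , λ del → deleted∉T ag f del f∈T

  agree-delete : ∀ {st st'} e → e FS.∉ T → Agree st st' →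
                 Agree (update G st e deleted) (update G st' e deleted)
  deleted⇒deleted' (agree-delete e e∉T ag) f del with f ≟ᶠ e
  ... | yes refl = refl
  ... | no _     = deleted⇒deleted' ag f del
  deleted'⇒deleted (agree-delete e e∉T ag) f del with f ≟ᶠ e
  ... | yes refl = refl
  ... | no _     = deleted'⇒deleted ag f del
  uncontracted'    (agree-delete e e∉T ag) f con with f ≟ᶠ e
  ... | yes refl with () ← con
  ... | no _     = uncontracted' ag f con
  contracted∈T     (agree-delete e e∉T ag) f con with f ≟ᶠ e
  ... | yes refl with () ← con
  ... | no _     = contracted∈T ag f con
  deleted∉T        (agree-delete e e∉T ag) f del with f ≟ᶠ e
  ... | yes refl = e∉T
  ... | no _     = deleted∉T ag f del

  agree-contract : ∀ {st st'} e → InH G st' e → e FS.∈ T → Agree st st' →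
                   Agree (update G st e contracted) st'
  deleted⇒deleted' (agree-contract e inH' e∈T ag) f del with f ≟ᶠ e
  ... | yes refl with () ← del
  ... | no _     = deleted⇒deleted' ag f del
  deleted'⇒deleted (agree-contract e inH' e∈T ag) f del with f ≟ᶠ e
  ... | yes refl with () ← trans (sym inH') del
  ... | no _     = deleted'⇒deleted ag f del
  uncontracted'    (agree-contract e inH' e∈T ag) = uncontracted' ag
  contracted∈T     (agree-contract e inH' e∈T ag) f con with f ≟ᶠ e
  ... | yes refl = e∈T
  ... | no _     = contracted∈T ag f con
  deleted∉T        (agree-contract e inH' e∈T ag) f del with f ≟ᶠ e
  ... | yes refl with () ← del
  ... | no _     = deleted∉T ag f del

  isthmus⇒isthmus' : ∀ {st st' e} → Agree st st' → Isthmus G st e → Isthmus G st' e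
  isthmus⇒isthmus' ag is = isthmus-transfer (deleted⇒deleted' ag) (present⇒present' ag (proj₁ is)) is

  isthmus'⇒isthmus : ∀ {st st' e} → Agree st st' → InH G st e → Isthmus G st' e → Isthmus G st e
  isthmus'⇒isthmus ag inH is = isthmus-transfer (deleted'⇒deleted ag) inH is

  -- Recording after deleting e never adds e, since e is no longer an edge.
  record-after-delete : ∀ {st e out} → Record G T (update G st e deleted) e out → out ≡ []
  record-after-delete {st} {e} (add (inH , _)) with () ← trans (sym (update-same st e deleted)) inH
  record-after-delete (skip _) = refl

  data Contribution (e : Fin m) (t : DType) : List (Fin m) → Set where
    typeI    : t ≡ I → Contribution e t (e ∷ [])
    notTypeI : t ≢ I → Contribution e t []

  step-correspondence : ∀ {st st' e t s₁ d₁ s₂ d₂ out} → Agree st st' →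
    TypeStep G T st e t s₁ d₁ → MoveStep G T st' e s₂ d₂ → Record G T s₂ e out →
    (d₁ ≡ d₂) × Agree s₁ s₂ × Contribution e t out
  step-correspondence {e = e} ag (stepSe _ e∉T) (goLeft _ _) rec with refl ← record-after-delete rec =
    refl , agree-delete e e∉T ag , notTypeI (λ ())
  step-correspondence ag (stepSe _ e∉T) (goRightT e∈T) _ = ⊥-elim (e∉T e∈T)
  step-correspondence ag (stepSe (inH , _ , ¬is) _) (goRightI is) _ = ⊥-elim (¬is (isthmus'⇒isthmus ag inH is))
  step-correspondence {e = e} ag (stepL _) (goLeft e∉T _) rec with refl ← record-after-delete rec =
    refl , agree-delete e e∉T ag , notTypeI (λ ())
  step-correspondence ag (stepL lp) (goRightT e∈T) _ = ⊥-elim (loop∉T ag lp e∈T)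
  step-correspondence ag (stepL lp) (goRightI is) _ = ⊥-elim (loop-not-isthmus lp (isthmus'⇒isthmus ag (proj₁ lp) is))
  step-correspondence ag (stepSi _ e∈T) (goLeft e∉T _) _ = ⊥-elim (e∉T e∈T)
  step-correspondence ag (stepSi (inH , _ , ¬is) _) (goRightT _) (add is) = ⊥-elim (¬is (isthmus'⇒isthmus ag inH is))
  step-correspondence {e = e} ag (stepSi (inH , _ , _) e∈T) (goRightT _) (skip _) =
    refl , agree-contract e (present⇒present' ag inH) e∈T ag , notTypeI (λ ())
  step-correspondence ag (stepSi (inH , _ , ¬is) _) (goRightI is) _ = ⊥-elim (¬is (isthmus'⇒isthmus ag inH is))
  step-correspondence ag (stepI is) (goLeft _ ¬is) _ = ⊥-elim (¬is (isthmus⇒isthmus' ag is))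
  step-correspondence {e = e} ag (stepI is) (goRightT _) (add _) =
    refl , agree-contract e (present⇒present' ag (proj₁ is)) (isthmus∈T ag is) ag , typeI refl
  step-correspondence ag (stepI is) (goRightT _) (skip ¬is) = ⊥-elim (¬is (isthmus⇒isthmus' ag is))
  step-correspondence {e = e} ag (stepI is) (goRightI _) (add _) =
    refl , agree-contract e (present⇒present' ag (proj₁ is)) (isthmus∈T ag is) ag , typeI refl
  step-correspondence ag (stepI is) (goRightI _) (skip ¬is) = ⊥-elim (¬is (isthmus⇒isthmus' ag is))

  contribution-membership : ∀ {e t out f rest types} → Contribution e t out →
    (f ∈ rest ⇔ (f , I) ∈ types) → (f ∈ out ++ rest) ⇔ ((f , I) ∈ (e , t) ∷ types)
  contribution-membership (typeI refl) ih =
    mk⇔ (λ { (here f≡e) → here (cong (_, I) f≡e) ; (there p) → there (Equivalence.to ih p) })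
        (λ { (here eq) → here (cong proj₁ eq) ; (there p) → there (Equivalence.from ih p) })
  contribution-membership (notTypeI t≢I) ih =
    mk⇔ (λ p → there (Equivalence.to ih p))
        (λ { (here eq) → ⊥-elim (t≢I (sym (cong proj₂ eq))) ; (there p) → Equivalence.from ih p })

  runs-correspond : ∀ {k} {Δ : BTree (Fin m) k} {st st' types intAct} → Agree st st' →
    TypeRun G T Δ st types → ProcRun G T Δ st' intAct → ∀ f → (f ∈ intAct) ⇔ ((f , I) ∈ types)
  runs-correspond ag (runLeaf ts) (procLeaf ms rec) f with step-correspondence ag ts ms rec
  ... | _ , _ , c = subst (λ out → (f ∈ out) ⇔ _) (++-identityʳ _) (contribution-membership c nothing)
    where
    nothing : (f ∈ []) ⇔ ((f , I) ∈ [])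
    nothing = mk⇔ (λ ()) (λ ())
  runs-correspond ag (runNode ts tr) (procNode ms rec pr) f with step-correspondence ag ts ms rec
  ... | refl , ag' , c = contribution-membership c (runs-correspond ag' tr pr f)

  typeStep-exists : ∀ st e → InH G st e →
    Σ DType λ t → Σ Bool λ d → TypeStep G T st e t (update G st e (if d then contracted else deleted)) d
  typeStep-exists st e inH with loop? st e
  ... | yes lp = L , false , stepL lp
  ... | no ¬lp with isthmus? st e
  ...   | yes is = I , true , stepI is
  ...   | no ¬is with e ∈? T
  ...     | yes e∈T = Si , true , stepSi (inH , ¬lp , ¬is) e∈T
  ...     | no e∉T  = Se , false , stepSe (inH , ¬lp , ¬is) e∉T

  typeRun-exists : ∀ {k} (Δ : BTree (Fin m) k) st → LabelsAvailable Δ st → Σ _ (TypeRun G T Δ st)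
  typeRun-exists (leaf e) st avail with avail []
  ... | _ , (inH ∷ []) with typeStep-exists st e inH
  ...   | _ , _ , ts = _ , runLeaf ts
  typeRun-exists {suc k} (node e l r) st avail with avail (false ∷ replicate k false)
  ... | _ , (inH ∷ _) with typeStep-exists st e inH
  ...   | _ , false , ts = _ , runNode ts (proj₂ (typeRun-exists l _ (labelsAvailable-child e l r st deleted false avail)))
  ...   | _ , true  , ts = _ , runNode ts (proj₂ (typeRun-exists r _ (labelsAvailable-child e l r st contracted true avail)))

  moveStep-exists : ∀ st e → Σ (Minor G) λ s → Σ Bool λ d → MoveStep G T st e s d
  moveStep-exists st e with e ∈? T
  ... | yes e∈T = st , true , goRightT e∈T
  ... | no e∉T with isthmus? st e
  ...   | yes is = st , true , goRightI is
  ...   | no ¬is = _ , false , goLeft e∉T ¬is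

  record-exists : ∀ s e → Σ _ (Record G T s e)
  record-exists s e with isthmus? s e
  ... | yes is = _ , add is
  ... | no ¬is = _ , skip ¬is

  procRun-exists : ∀ {k} (Δ : BTree (Fin m) k) st → Σ _ (ProcRun G T Δ st)
  procRun-exists (leaf e) st with moveStep-exists st e
  ... | s , _ , ms = _ , procLeaf ms (proj₂ (record-exists s e))
  procRun-exists (node e l r) st with moveStep-exists st e
  ... | s , false , ms = _ , procNode ms (proj₂ (record-exists s e)) (proj₂ (procRun-exists l s))
  ... | s , true  , ms = _ , procNode ms (proj₂ (record-exists s e)) (proj₂ (procRun-exists r s))


-- The theorem: both runs exist, and IntAct is exactly the set of edges of
-- Δ-type I.
proposition4p5 : ∀ {n k : ℕ} (G : Graph n (suc k)) → Connected G →
    (Δ : BTree (Fin (suc k)) k) → IsDecisionTree Δ →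
    (T : Subset (suc k)) → SpanningTree G T →
    ((Σ (List (Fin (suc k) × DType)) λ out → TypeRun G T Δ (initial G) out) ×
     (Σ (List (Fin (suc k))) λ intAct → ProcRun G T Δ (initial G) intAct)) ×
    (∀ (out : List (Fin (suc k) × DType)) → TypeRun G T Δ (initial G) out →
     ∀ (intAct : List (Fin (suc k))) → ProcRun G T Δ (initial G) intAct →
     ∀ (e : Fin (suc k)) → (e ∈ intAct) ⇔ ((e , I) ∈ out))
proposition4p5 G _ Δ isDT T tree =
  (typeRun-exists Δ (initial G) (decisionTree-labelsAvailable G isDT) , procRun-exists Δ (initial G)) ,
  (λ _ typeRun _ procRun → runs-correspond agree-initial typeRun procRun)
  where open Correspondence G T tree
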